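{- Let $H$ be a skew Hadamard matrix of order $n$ and let $\{i,j,k,\ell\}$ be a quadruple of row indices. Then: (i) if the quadruple $\{i,j,k,\ell\}$ of rows of $H$ has skew type $(t,0)$, then the quadruple $\{i,j,k,\ell\}$ of rows of $H^\top$ has skew type $(t-1,2)$; (ii) if the quadruple $\{i,j,k,\ell\}$ of rows of $H$ has skew type $(t,1)$, then the quadruple $\{i,j,k,\ell\}$ of rows of $H^\top$ has skew type $(t,1)$; (iii) if the quadruple $\{i,j,k,\ell\}$ of rows of $H$ has skew type $(s,2)$, then the quadruple $\{i,j,k,\ell\}$ of rows of $H^\top$ has skew type $(s-1,2)$ if $s=\frac n8$; $(s,2)$ if $s=\frac{n-4}{8}$; $(s+1,2)$ if $s=\frac n8-1$; and $(s+1,0)$ otherwise.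
   Context: A Hadamard matrix of order $n$ is an $n\times n$ matrix $H$ with entries in $\{ -1,1\}$ and $HH^\top=nI$; it is skew Hadamard if moreover $H+H^\top=2I$ (then $H^\top$ is also skew Hadamard). A signed permutation matrix is a matrix with entries in $\{ -1,0,1\}$ with exactly one nonzero entry in each row and each column. Skew type of a quadruple: for a skew Hadamard $H$ of order $n$ and a quadruple of rows $\{i,j,k,\ell\}$, there is a signed permutation matrix $P$ such that in $P^\top HP$ the quadruple becomes rows $1,2,3,4$ and, writing $G=[g_{uv}]=P^\top HP$, one of the following holds. (F1) The leading $4\times4$ block of $G$ is $A=\begin{pmatrix}1&1&1&1\\-1&1&1&1\\-1&-1&1&1\\-1&-1&-1&1\end{pmatrix}$, and among the columns $c=5,\dots,n$ the vectors $(g_{1c},g_{2c},g_{3c},g_{4c})$ equal $(1,1,1,1)$ exactly $s-1$ times, $(1,1,1,-1)$ exactly $t-1$ times, $(1,1,-1,1)$ exactly $t$ times, $(1,1,-1,-1)$ exactly $s-1$ times, $(1,-1,1,1)$ exactly $t$ times, $(1,-1,1,-1)$ exactly $s$ times, $(1,-1,-1,1)$ exactly $s$ times, $(1,-1,-1,-1)$ exactly $t-1$ times, where $s,t\geqslant1$ are integers with $s+t=n/4$. (F2) The leading $4\times4$ block of $G$ is $B=\begin{pmatrix}1&1&1&1\\-1&1&1&-1\\-1&-1&1&1\\-1&1&-1&1\end{pmatrix}$, and among the columns $c=5,\dots,n$ the vectors $(g_{1c},g_{2c},g_{3c},g_{4c})$ equal $(1,1,1,1)$ exactly $s$ times, $(1,1,1,-1)$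 exactly $t-1$ times, $(1,1,-1,1)$ exactly $t-1$ times, $(1,1,-1,-1)$ exactly $s$ times, $(1,-1,1,1)$ exactly $t-1$ times, $(1,-1,1,-1)$ exactly $s$ times, $(1,-1,-1,1)$ exactly $s$ times, $(1,-1,-1,-1)$ exactly $t-1$ times, where $s\geqslant0$, $t\geqslant1$ are integers with $s+t=n/4$. The skew type of the quadruple is $(\min\{s,t\},1)$ in case (F1); in case (F2) it is $(s,2)$ if $s\leqslant t$ and $(t,0)$ if $s>t$ (these are well defined). -}

module Defs where

open import Data.Nat using (ℕ; zero; suc; _+_; _*_; _∸_; _≤_; _<_)
open import Data.Integer as ℤ using (ℤ; +_; 1ℤ; -1ℤ; 0ℤ)
open import Data.Fin using (Fin; zero; suc; _↑ˡ_; _↑ʳ_; _≟_)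
open import Data.Vec using (Vec; []; _∷_; lookup; tabulate)
open import Data.Vec.Properties using (≡-dec)
open import Data.Bool using (Bool; true; false; if_then_else_)
open import Data.Product using (Σ; ∃; _×_; _,_)
open import Data.Sum using (_⊎_)
open import Relation.Nullary using (¬_)
open import Relation.Nullary.Decidable using (⌊_⌋)
open import Relation.Binary.PropositionalEquality using (_≡_; _≢_)

Mat : ℕ → Set
Mat n = Fin n → Fin n → ℤ

Σᶠ : ∀ {n} → (Fin n → ℤ) → ℤ
Σᶠ {zero}  f = 0ℤ
Σᶠ {suc n} f = f zero ℤ.+ Σᶠ (λ i → f (suc i))

countᶠ : ∀ {n} → (Fin n → Bool) → ℕ
countᶠ {zero}  p = 0
countᶠ {suc n} p = (if p zero then 1 else 0) + countᶠ (λ i → p (suc i))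

_ᵀ : ∀ {n} → Mat n → Mat n
(M ᵀ) a b = M b a

_⊗_ : ∀ {n} → Mat n → Mat n → Mat n
(M ⊗ N) a b = Σᶠ (λ c → M a c ℤ.* N c b)

idM : ∀ {n} → Mat n
idM a b = if ⌊ a ≟ b ⌋ then 1ℤ else 0ℤ

IsHadamard : ∀ n → Mat n → Set
IsHadamard n H =
  (∀ a b → H a b ≡ 1ℤ ⊎ H a b ≡ -1ℤ) ×
  (∀ a b → (H ⊗ (H ᵀ)) a b ≡ (+ n) ℤ.* idM a b)

IsSkewHadamard : ∀ n → Mat n → Set
IsSkewHadamard n H =
  IsHadamard n H × (∀ a b → H a b ℤ.+ H b a ≡ (+ 2) ℤ.* idM a b)

IsSignedPerm : ∀ n → Mat n → Set
IsSignedPerm n P =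
  (∀ a b → P a b ≡ 1ℤ ⊎ (P a b ≡ 0ℤ ⊎ P a b ≡ -1ℤ)) ×
  (∀ a → ∃ λ b → P a b ≢ 0ℤ × (∀ b' → P a b' ≢ 0ℤ → b' ≡ b)) ×
  (∀ b → ∃ λ a → P a b ≢ 0ℤ × (∀ a' → P a' b ≢ 0ℤ → a' ≡ a))

blockA : Fin 4 → Fin 4 → ℤ
blockA u v = lookup (lookup rows u) v
  where
  rows : Vec (Vec ℤ 4) 4
  rows = (1ℤ ∷ 1ℤ ∷ 1ℤ ∷ 1ℤ ∷ [])
       ∷ (-1ℤ ∷ 1ℤ ∷ 1ℤ ∷ 1ℤ ∷ [])
       ∷ (-1ℤ ∷ -1ℤ ∷ 1ℤ ∷ 1ℤ ∷ [])
       ∷ (-1ℤ ∷ -1ℤ ∷ -1ℤ ∷ 1ℤ ∷ [])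
       ∷ []

blockB : Fin 4 → Fin 4 → ℤ
blockB u v = lookup (lookup rows u) v
  where
  rows : Vec (Vec ℤ 4) 4
  rows = (1ℤ ∷ 1ℤ ∷ 1ℤ ∷ 1ℤ ∷ [])
       ∷ (-1ℤ ∷ 1ℤ ∷ 1ℤ ∷ -1ℤ ∷ [])
       ∷ (-1ℤ ∷ -1ℤ ∷ 1ℤ ∷ 1ℤ ∷ [])
       ∷ (-1ℤ ∷ 1ℤ ∷ -1ℤ ∷ 1ℤ ∷ [])
       ∷ []

pat : ℤ → ℤ → ℤ → ℤ → Vec ℤ 4
pat a b c d = a ∷ b ∷ c ∷ d ∷ []

-- Matrices of order n = 4 + m; rows/columns 1..4 of the paper are
-- u ↑ˡ m (u : Fin 4), columns 5..n are 4 ↑ʳ c (c : Fin m).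

colCount : ∀ m → Mat (4 + m) → Vec ℤ 4 → ℕ
colCount m G p =
  countᶠ (λ (c : Fin m) →
    ⌊ ≡-dec ℤ._≟_ (tabulate (λ u → G (u ↑ˡ m) (4 ↑ʳ c))) p ⌋)

LeadingBlock : ∀ m → Mat (4 + m) → (Fin 4 → Fin 4 → ℤ) → Set
LeadingBlock m G X = ∀ u v → G (u ↑ˡ m) (v ↑ˡ m) ≡ X u v

F1 : ∀ m → Mat (4 + m) → ℕ → ℕ → Set
F1 m G s t =
  1 ≤ s × 1 ≤ t × 4 * (s + t) ≡ 4 + m ×
  LeadingBlock m G blockA ×
  colCount m G (pat 1ℤ 1ℤ 1ℤ 1ℤ)     ≡ s ∸ 1 ×
  colCount m G (pat 1ℤ 1ℤ 1ℤ -1ℤ)    ≡ t ∸ 1 ×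
  colCount m G (pat 1ℤ 1ℤ -1ℤ 1ℤ)    ≡ t ×
  colCount m G (pat 1ℤ 1ℤ -1ℤ -1ℤ)   ≡ s ∸ 1 ×
  colCount m G (pat 1ℤ -1ℤ 1ℤ 1ℤ)    ≡ t ×
  colCount m G (pat 1ℤ -1ℤ 1ℤ -1ℤ)   ≡ s ×
  colCount m G (pat 1ℤ -1ℤ -1ℤ 1ℤ)   ≡ s ×
  colCount m G (pat 1ℤ -1ℤ -1ℤ -1ℤ)  ≡ t ∸ 1

F2 : ∀ m → Mat (4 + m) → ℕ → ℕ → Set
F2 m G s t =
  1 ≤ t × 4 * (s + t) ≡ 4 + m ×
  LeadingBlock m G blockB ×
  colCount m G (pat 1ℤ 1ℤ 1ℤ 1ℤ)     ≡ s ×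
  colCount m G (pat 1ℤ 1ℤ 1ℤ -1ℤ)    ≡ t ∸ 1 ×
  colCount m G (pat 1ℤ 1ℤ -1ℤ 1ℤ)    ≡ t ∸ 1 ×
  colCount m G (pat 1ℤ 1ℤ -1ℤ -1ℤ)   ≡ s ×
  colCount m G (pat 1ℤ -1ℤ 1ℤ 1ℤ)    ≡ t ∸ 1 ×
  colCount m G (pat 1ℤ -1ℤ 1ℤ -1ℤ)   ≡ s ×
  colCount m G (pat 1ℤ -1ℤ -1ℤ 1ℤ)   ≡ s ×
  colCount m G (pat 1ℤ -1ℤ -1ℤ -1ℤ)  ≡ t ∸ 1

min : ℕ → ℕ → ℕ
min = Data.Nat._⊓_
  where import Data.Nat

TypeValue : ∀ m → Mat (4 + m) → ℕ → ℕ → Set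
TypeValue m G a b =
  (∃ λ s → ∃ λ t → F1 m G s t × a ≡ min s t × b ≡ 1) ⊎
  (∃ λ s → ∃ λ t → F2 m G s t ×
     ((s ≤ t × a ≡ s × b ≡ 2) ⊎ (t < s × a ≡ t × b ≡ 0)))

-- The quadruple {i,j,k,l} of rows of the skew Hadamard matrix H
-- (of order 4 + m) has skew type (a , b): there is a signed permutation
-- matrix P such that in G = Pᵀ H P the quadruple becomes rows 1..4
-- (i.e. the nonzero entry of each of the first four columns of P lies
-- in a row among i, j, k, l) and G satisfies (F1) or (F2) with the
-- corresponding type value.
HasSkewType : ∀ m → Mat (4 + m) → (i j k l : Fin (4 + m)) → ℕ → ℕ → Set
HasSkewType m H i j k l a b =
  ∃ λ (P : Mat (4 + m)) →
    IsSignedPerm (4 + m) P ×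
    (∀ (u : Fin 4) (r : Fin (4 + m)) → P r (u ↑ˡ m) ≢ 0ℤ →
       r ≡ i ⊎ (r ≡ j ⊎ (r ≡ k ⊎ r ≡ l))) ×
    TypeValue m (((P ᵀ) ⊗ H) ⊗ P) a b

Distinct4 : ∀ {n} → (i j k l : Fin n) → Set
Distinct4 i j k l = i ≢ j × i ≢ k × i ≢ l × j ≢ k × j ≢ l × k ≢ l

{-# OPTIONS --safe #-}
-- Let P bring the quadruple of H into the normal form (F1) or (F2) and put G = Pᵀ H P.
-- Conjugating Hᵀ by P gives Gᵀ, which is brought back into normal form by a further signed
-- permutation: an involution f of the four leading indices (the reversal for (F1), the
-- transposition of the last two for (F2)) with signs d, and on every other column c the sign
-- that makes the first row all ones. Because G is skew, row c of G is minus column c, so each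
-- leading column vector of the new matrix is the image of the corresponding one of G under an
-- explicit involution of the eight sign patterns with first entry 1. These eight counts of G
-- already add up to n − 4, so every column of G has such a pattern and the new counts are the
-- old ones permuted: (F1) with (s, t) becomes (F1) with (s, t), and (F2) with (s, t) becomes
-- (F2) with (t − 1, s + 1). The three statements are the arithmetic of types that follows.
module Submission where

open import Defs
open import Data.Bool using (Bool; true; false; if_then_else_; T)
open import Data.Fin using (Fin; zero; suc; _↑ˡ_; _↑ʳ_; _≟_; splitAt; join)
open import Data.Fin.Patterns using (0F; 2F; 3F)
open import Data.Fin.Properties
  using (suc-injective; splitAt-↑ˡ; splitAt-↑ʳ; splitAt-join; join-splitAt; all?)
open import Data.Fin.Permutation
  using (Permutation′; permutation; _⟨$⟩ʳ_; _⟨$⟩ˡ_; inverseˡ; inverseʳ; _∘ₚ_; transpose; reverse)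
open import Data.Integer as ℤ using (ℤ; 1ℤ; -1ℤ; 0ℤ; -_) renaming (_*_ to _·_)
import Data.Integer.Properties as ℤ
open import Data.Integer.Tactic.RingSolver using (solve-∀)
open import Data.List using (List; []; _∷_; map)
open import Data.List.Relation.Binary.Pointwise using ([]; _∷_; Pointwise-≡⇒≡)
open import Data.List.Relation.Unary.All as All using (All)
open import Data.List.Relation.Unary.AllPairs using ([]; _∷_)
open import Data.List.Relation.Unary.Unique.Propositional using (Unique)
open import Data.Nat as ℕ using (ℕ; zero; suc; _+_; _*_; _∸_; _≤_; _<_; s≤s; z≤n)
import Data.Nat.Properties as ℕ
open import Data.Nat.ListAction using (sum)
open import Data.Nat.Tactic.RingSolver using () renaming (solve-∀ to ℕ-solve-∀)
open import Algebra.Properties.AbelianGroup ℤ.+-0-abelianGroup using (inverseʳ-unique)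
open import Algebra.Properties.CommutativeSemigroup ℕ.+-commutativeSemigroup using (interchange)
open import Data.Product using (∃; _×_; _,_; proj₁; proj₂)
open import Data.Sum as Sum using (_⊎_; inj₁; inj₂; [_,_]′; map₁)
open import Data.Unit using (tt)
open import Data.Vec using (Vec; lookup; tabulate)
open import Data.Vec.Properties using (≡-dec; tabulate-cong; lookup∘tabulate)
open import Function using (_∘_)
open import Relation.Binary.Definitions using (DecidableEquality)
open import Relation.Binary.PropositionalEquality
open import Relation.Nullary using (Dec; yes; no; contradiction)
open import Relation.Nullary.Decidable using (⌊_⌋; True; toWitness; from-yes)

IsSign : ℤ → Set
IsSign x = x ≡ 1ℤ ⊎ x ≡ -1ℤ

sign-· : ∀ {x y} → IsSign x → IsSign y → IsSign (x · y)
sign-· (inj₁ refl) (inj₁ refl) = inj₁ refl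
sign-· (inj₁ refl) (inj₂ refl) = inj₂ refl
sign-· (inj₂ refl) (inj₁ refl) = inj₂ refl
sign-· (inj₂ refl) (inj₂ refl) = inj₁ refl

sign⇒≢0 : ∀ {x} → IsSign x → x ≢ 0ℤ
sign⇒≢0 (inj₁ refl) ()
sign⇒≢0 (inj₂ refl) ()

⌊⌋-cong : ∀ {A B : Set} → (A → B) → (B → A) → (a? : Dec A) (b? : Dec B) → ⌊ a? ⌋ ≡ ⌊ b? ⌋
⌊⌋-cong to from (yes a) (yes b) = refl
⌊⌋-cong to from (yes a) (no ¬b) = contradiction (to a) ¬b
⌊⌋-cong to from (no ¬a) (yes b) = contradiction (from b) ¬a
⌊⌋-cong to from (no ¬a) (no ¬b) = refl

indicator : Bool → ℕ
indicator b = if b then 1 else 0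

countᶠ-cong : ∀ {n} {p q : Fin n → Bool} → (∀ c → p c ≡ q c) → countᶠ p ≡ countᶠ q
countᶠ-cong {zero}  p≡q = refl
countᶠ-cong {suc n} p≡q = cong₂ _+_ (cong indicator (p≡q zero)) (countᶠ-cong (p≡q ∘ suc))

countᶠ-false : ∀ {n} → countᶠ {n} (λ _ → false) ≡ 0
countᶠ-false {zero}  = refl
countᶠ-false {suc n} = countᶠ-false {n}

countᶠ-+ : ∀ {n} (p q r : Fin n → Bool) →
  (∀ c → indicator (p c) ≡ indicator (q c) + indicator (r c)) → countᶠ p ≡ countᶠ q + countᶠ r
countᶠ-+ {zero}  p q r split = refl
countᶠ-+ {suc n} p q r split = begin
  indicator (p zero) + countᶠ (p ∘ suc)
    ≡⟨ cong₂ _+_ (split zero) (countᶠ-+ (p ∘ suc) (q ∘ suc) (r ∘ suc) (split ∘ suc)) ⟩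
  (indicator (q zero) + indicator (r zero)) + (countᶠ (q ∘ suc) + countᶠ (r ∘ suc))
    ≡⟨ interchange (indicator (q zero)) (indicator (r zero)) _ _ ⟩
  (indicator (q zero) + countᶠ (q ∘ suc)) + (indicator (r zero) + countᶠ (r ∘ suc)) ∎
  where open ≡-Reasoning

countᶠ≤ : ∀ {n} (p : Fin n → Bool) → countᶠ p ≤ n
countᶠ≤ {zero}  p = z≤n
countᶠ≤ {suc n} p with p zero
... | true  = s≤s (countᶠ≤ (p ∘ suc))
... | false = ℕ.m≤n⇒m≤1+n (countᶠ≤ (p ∘ suc))

countᶠ-< : ∀ {n} (p : Fin n → Bool) c → p c ≡ false → countᶠ p < n
countᶠ-< p zero    pc≡false rewrite pc≡false = s≤s (countᶠ≤ (p ∘ suc))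
countᶠ-< p (suc c) pc≡false with p zero
... | true  = s≤s (countᶠ-< (p ∘ suc) c pc≡false)
... | false = ℕ.m≤n⇒m≤1+n (countᶠ-< (p ∘ suc) c pc≡false)

countᶠ-full : ∀ {n} (p : Fin n → Bool) → countᶠ p ≡ n → ∀ c → T (p c)
countᶠ-full p full c with p c in pc≡
... | true  = tt
... | false = contradiction full (ℕ.<⇒≢ (countᶠ-< p c pc≡))

module _ {A : Set} (_≟ₐ_ : DecidableEquality A) where
  open import Data.List.Membership.DecPropositional _≟ₐ_ using (_∈?_)

  indicator-∈?-∷ : ∀ {x xs} → All (x ≢_) xs → ∀ y →
    indicator ⌊ y ∈? x ∷ xs ⌋ ≡ indicator ⌊ y ≟ₐ x ⌋ + indicator ⌊ y ∈? xs ⌋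
  indicator-∈?-∷ {x} {xs} x∉xs y with y ≟ₐ x | y ∈? xs
  ... | yes refl | yes y∈xs = contradiction refl (All.lookup x∉xs y∈xs)
  ... | yes refl | no _     = refl
  ... | no _     | yes _    = refl
  ... | no _     | no _     = refl

  countᶠ-distinct : ∀ {n} (g : Fin n → A) {xs} → Unique xs →
    sum (map (λ x → countᶠ (λ c → ⌊ g c ≟ₐ x ⌋)) xs) ≡ countᶠ (λ c → ⌊ g c ∈? xs ⌋)
  countᶠ-distinct {n} g [] = sym (countᶠ-false {n})
  countᶠ-distinct g {x ∷ xs} (x∉xs ∷ xs-distinct) = begin
    countᶠ (λ c → ⌊ g c ≟ₐ x ⌋) + sum (map (λ x → countᶠ (λ c → ⌊ g c ≟ₐ x ⌋)) xs)
      ≡⟨ cong (countᶠ (λ c → ⌊ g c ≟ₐ x ⌋) +_) (countᶠ-distinct g xs-distinct) ⟩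
    countᶠ (λ c → ⌊ g c ≟ₐ x ⌋) + countᶠ (λ c → ⌊ g c ∈? xs ⌋)
      ≡⟨ countᶠ-+ _ _ _ (indicator-∈?-∷ x∉xs ∘ g) ⟨
    countᶠ (λ c → ⌊ g c ∈? x ∷ xs ⌋) ∎
    where open ≡-Reasoning

  countᶠ-involution : ∀ {n} {S : A → Set} (W : A → A) → (∀ {x} → S x → W (W x) ≡ x) →
    (g : Fin n → A) → (∀ c → S (g c)) → ∀ {p} → S p →
    countᶠ (λ c → ⌊ W (g c) ≟ₐ p ⌋) ≡ countᶠ (λ c → ⌊ g c ≟ₐ W p ⌋)
  countᶠ-involution W involutive g g∈S p∈S = countᶠ-cong λ c →
    ⌊⌋-cong (λ e → trans (sym (involutive (g∈S c))) (cong W e))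
            (λ e → trans (cong W e) (involutive p∈S))
            (W (g c) ≟ₐ _) (g c ≟ₐ W _)

Σᶠ-zero : ∀ {n} (f : Fin n → ℤ) → (∀ c → f c ≡ 0ℤ) → Σᶠ f ≡ 0ℤ
Σᶠ-zero {zero}  f f≡0 = refl
Σᶠ-zero {suc n} f f≡0 = cong₂ ℤ._+_ (f≡0 zero) (Σᶠ-zero (f ∘ suc) (f≡0 ∘ suc))

Σᶠ-single : ∀ {n} (f : Fin n → ℤ) (c₀ : Fin n) → (∀ c → c ≢ c₀ → f c ≡ 0ℤ) → Σᶠ f ≡ f c₀
Σᶠ-single {suc n} f zero f≡0 = begin
  f zero ℤ.+ Σᶠ (f ∘ suc) ≡⟨ cong (λ x → f zero ℤ.+ x) (Σᶠ-zero (f ∘ suc) (λ c → f≡0 (suc c) λ ())) ⟩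
  f zero ℤ.+ 0ℤ           ≡⟨ ℤ.+-identityʳ (f zero) ⟩
  f zero                  ∎
  where open ≡-Reasoning
Σᶠ-single {suc n} f (suc c₀) f≡0 = begin
  f zero ℤ.+ Σᶠ (f ∘ suc) ≡⟨ cong (λ x → x ℤ.+ Σᶠ (f ∘ suc)) (f≡0 zero λ ()) ⟩
  0ℤ ℤ.+ Σᶠ (f ∘ suc)     ≡⟨ ℤ.+-identityˡ _ ⟩
  Σᶠ (f ∘ suc)            ≡⟨ Σᶠ-single (f ∘ suc) c₀ (λ c c≢c₀ → f≡0 (suc c) (c≢c₀ ∘ suc-injective)) ⟩
  f (suc c₀)              ∎
  where open ≡-Reasoning

conjugate-entry-supported : ∀ {n} {P : Mat n} (π : Fin n → Fin n) →
  (∀ r b → r ≢ π b → P r b ≡ 0ℤ) →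
  ∀ M a b → (((P ᵀ) ⊗ M) ⊗ P) a b ≡ (P (π a) a · M (π a) (π b)) · P (π b) b
conjugate-entry-supported {P = P} π off M a b = begin
  Σᶠ (λ c → PᵀM a c · P c b)               ≡⟨ Σᶠ-single _ (π b) outer-zero ⟩
  PᵀM a (π b) · P (π b) b                  ≡⟨ cong (_· P (π b) b) (Σᶠ-single _ (π a) inner-zero) ⟩
  (P (π a) a · M (π a) (π b)) · P (π b) b ∎
  where
  open ≡-Reasoning
  PᵀM = (P ᵀ) ⊗ M
  outer-zero : ∀ c → c ≢ π b → PᵀM a c · P c b ≡ 0ℤ
  outer-zero c c≢ = trans (cong (PᵀM a c ·_) (off c b c≢)) (ℤ.*-zeroʳ (PᵀM a c))
  inner-zero : ∀ r → r ≢ π a → P r a · M r (π b) ≡ 0ℤ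
  inner-zero r r≢ = trans (cong (_· M r (π b)) (off r a r≢)) (ℤ.*-zeroˡ (M r (π b)))

skewHadamard-antisym : ∀ {n H} → IsSkewHadamard n H → ∀ {x y} → x ≢ y → H y x ≡ - H x y
skewHadamard-antisym {H = H} (_ , skew) {x} {y} x≢y = inverseʳ-unique (H x y) (H y x) (begin
  H x y ℤ.+ H y x    ≡⟨ skew x y ⟩
  ℤ.+ 2 · idM x y    ≡⟨ cong (ℤ.+ 2 ·_) idM-off ⟩
  0ℤ                 ∎)
  where
  open ≡-Reasoning
  idM-off : idM x y ≡ 0ℤ
  idM-off with x ≟ y
  ... | yes x≡y = contradiction x≡y x≢y
  ... | no _    = refl

module SignedPerm {n} {P : Mat n} (isSignedPerm : IsSignedPerm n P) where
  private
    entries = proj₁ isSignedPerm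
    rows    = proj₁ (proj₂ isSignedPerm)
    cols    = proj₂ (proj₂ isSignedPerm)

    rowOf : Fin n → Fin n
    rowOf b = proj₁ (cols b)

    colOf : Fin n → Fin n
    colOf r = proj₁ (rows r)

  perm : Permutation′ n
  perm = permutation rowOf colOf
    (λ r → sym (proj₂ (proj₂ (cols (colOf r))) r (proj₁ (proj₂ (rows r)))))
    (λ b → sym (proj₂ (proj₂ (rows (rowOf b))) b (proj₁ (proj₂ (cols b)))))

  sign : Fin n → ℤ
  sign b = P (perm ⟨$⟩ʳ b) b

  sign-isSign : ∀ b → IsSign (sign b)
  sign-isSign b with entries (rowOf b) b
  ... | inj₁ e        = inj₁ e
  ... | inj₂ (inj₁ e) = contradiction e (proj₁ (proj₂ (cols b)))
  ... | inj₂ (inj₂ e) = inj₂ e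

  off-support : ∀ r b → r ≢ perm ⟨$⟩ʳ b → P r b ≡ 0ℤ
  off-support r b r≢ with P r b ℤ.≟ 0ℤ
  ... | yes e  = e
  ... | no ≢0 = contradiction (proj₂ (proj₂ (cols b)) r ≢0) r≢

  conjugate-entry : ∀ M a b → (((P ᵀ) ⊗ M) ⊗ P) a b ≡ (sign a · M (perm ⟨$⟩ʳ a) (perm ⟨$⟩ʳ b)) · sign b
  conjugate-entry = conjugate-entry-supported (perm ⟨$⟩ʳ_) off-support

  conjugate-isSign : ∀ {M} → (∀ x y → IsSign (M x y)) → ∀ a b → IsSign ((((P ᵀ) ⊗ M) ⊗ P) a b)
  conjugate-isSign {M} M-sign a b = subst IsSign (sym (conjugate-entry M a b))
    (sign-· (sign-· (sign-isSign a) (M-sign _ _)) (sign-isSign b))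

  conjugate-antisym : ∀ {M} → (∀ {x y} → x ≢ y → M y x ≡ - M x y) →
                      ∀ {a b} → a ≢ b → (((P ᵀ) ⊗ M) ⊗ P) b a ≡ - (((P ᵀ) ⊗ M) ⊗ P) a b
  conjugate-antisym {M} M-antisym {a} {b} a≢b = begin
    (((P ᵀ) ⊗ M) ⊗ P) b a                 ≡⟨ conjugate-entry M b a ⟩
    (sign b · M (π b) (π a)) · sign a     ≡⟨ cong (λ x → (sign b · x) · sign a) (M-antisym πa≢πb) ⟩
    (sign b · - M (π a) (π b)) · sign a   ≡⟨ reorder (sign b) (M (π a) (π b)) (sign a) ⟩
    - ((sign a · M (π a) (π b)) · sign b) ≡⟨ cong -_ (sym (conjugate-entry M a b)) ⟩
    - (((P ᵀ) ⊗ M) ⊗ P) a b               ∎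
    where
    open ≡-Reasoning
    π = perm ⟨$⟩ʳ_
    πa≢πb : π a ≢ π b
    πa≢πb e = a≢b (trans (sym (inverseˡ perm)) (trans (cong (perm ⟨$⟩ˡ_) e) (inverseˡ perm)))
    reorder : ∀ x y z → (x · - y) · z ≡ - ((z · y) · x)
    reorder = solve-∀

monomial : ∀ {n} → Permutation′ n → (Fin n → ℤ) → Mat n
monomial π ε r b = if ⌊ r ≟ π ⟨$⟩ʳ b ⌋ then ε b else 0ℤ

module _ {n} (π : Permutation′ n) (ε : Fin n → ℤ) where

  monomial-on : ∀ b → monomial π ε (π ⟨$⟩ʳ b) b ≡ ε b
  monomial-on b with π ⟨$⟩ʳ b ≟ π ⟨$⟩ʳ b
  ... | yes _   = refl
  ... | no b≢b = contradiction refl b≢b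

  monomial-off : ∀ r b → r ≢ π ⟨$⟩ʳ b → monomial π ε r b ≡ 0ℤ
  monomial-off r b r≢ with r ≟ π ⟨$⟩ʳ b
  ... | yes r≡ = contradiction r≡ r≢
  ... | no _   = refl

  monomial-support : ∀ {r b} → monomial π ε r b ≢ 0ℤ → r ≡ π ⟨$⟩ʳ b
  monomial-support {r} {b} ≢0 with r ≟ π ⟨$⟩ʳ b
  ... | yes r≡ = r≡
  ... | no _   = contradiction refl ≢0

  monomial-isSignedPerm : (∀ b → IsSign (ε b)) → IsSignedPerm n (monomial π ε)
  monomial-isSignedPerm ε-sign = entries , rows , cols
    where
    entries : ∀ r b → monomial π ε r b ≡ 1ℤ ⊎ (monomial π ε r b ≡ 0ℤ ⊎ monomial π ε r b ≡ -1ℤ)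
    entries r b with r ≟ π ⟨$⟩ʳ b | ε-sign b
    ... | yes _ | inj₁ e = inj₁ e
    ... | yes _ | inj₂ e = inj₂ (inj₂ e)
    ... | no _  | _      = inj₂ (inj₁ refl)

    on-≢0 : ∀ b → monomial π ε (π ⟨$⟩ʳ b) b ≢ 0ℤ
    on-≢0 b e = sign⇒≢0 (ε-sign b) (trans (sym (monomial-on b)) e)

    rows : ∀ r → ∃ λ b → monomial π ε r b ≢ 0ℤ × (∀ b′ → monomial π ε r b′ ≢ 0ℤ → b′ ≡ b)
    rows r = π ⟨$⟩ˡ r
           , subst (λ r′ → monomial π ε r′ (π ⟨$⟩ˡ r) ≢ 0ℤ) (inverseʳ π) (on-≢0 (π ⟨$⟩ˡ r))
           , λ b′ ≢0 → trans (sym (inverseˡ π)) (cong (π ⟨$⟩ˡ_) (sym (monomial-support ≢0)))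

    cols : ∀ b → ∃ λ r → monomial π ε r b ≢ 0ℤ × (∀ r′ → monomial π ε r′ b ≢ 0ℤ → r′ ≡ r)
    cols b = π ⟨$⟩ʳ b , on-≢0 b , λ r′ → monomial-support

-- reflected is P Q for the signed permutation matrix Q of σ and δ, so conjugating Mᵀ by it
-- gives Qᵀ (Pᵀ M P)ᵀ Q.
module Reflection {n} {P : Mat n} (isSignedPerm : IsSignedPerm n P)
                  (σ : Permutation′ n) (δ : Fin n → ℤ) where
  open SignedPerm isSignedPerm

  private
    ε′ : Fin n → ℤ
    ε′ a = sign (σ ⟨$⟩ʳ a) · δ a

  reflected : Mat n
  reflected = monomial (σ ∘ₚ perm) ε′

  reflected-isSignedPerm : (∀ a → IsSign (δ a)) → IsSignedPerm n reflected
  reflected-isSignedPerm δ-sign =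
    monomial-isSignedPerm (σ ∘ₚ perm) ε′ (λ a → sign-· (sign-isSign (σ ⟨$⟩ʳ a)) (δ-sign a))

  reflected-support : ∀ {r a} → reflected r a ≢ 0ℤ → P r (σ ⟨$⟩ʳ a) ≢ 0ℤ
  reflected-support {a = a} ≢0 =
    subst (λ r → P r (σ ⟨$⟩ʳ a) ≢ 0ℤ) (sym (monomial-support (σ ∘ₚ perm) ε′ ≢0))
      (sign⇒≢0 (sign-isSign (σ ⟨$⟩ʳ a)))

  conjugate-reflected : ∀ M a b →
    (((reflected ᵀ) ⊗ (M ᵀ)) ⊗ reflected) a b ≡ (δ a · δ b) · (((P ᵀ) ⊗ M) ⊗ P) (σ ⟨$⟩ʳ b) (σ ⟨$⟩ʳ a)
  conjugate-reflected M a b = begin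
    (((reflected ᵀ) ⊗ (M ᵀ)) ⊗ reflected) a b
      ≡⟨ conjugate-entry-supported (π ∘ σ′) (monomial-off (σ ∘ₚ perm) ε′) (M ᵀ) a b ⟩
    (reflected (π (σ′ a)) a · M (π (σ′ b)) (π (σ′ a))) · reflected (π (σ′ b)) b
      ≡⟨ cong₂ (λ x y → (x · M (π (σ′ b)) (π (σ′ a))) · y)
               (monomial-on (σ ∘ₚ perm) ε′ a) (monomial-on (σ ∘ₚ perm) ε′ b) ⟩
    ((sign (σ′ a) · δ a) · M (π (σ′ b)) (π (σ′ a))) · (sign (σ′ b) · δ b)
      ≡⟨ reorder (sign (σ′ a)) (δ a) (M (π (σ′ b)) (π (σ′ a))) (sign (σ′ b)) (δ b) ⟩
    (δ a · δ b) · ((sign (σ′ b) · M (π (σ′ b)) (π (σ′ a))) · sign (σ′ a))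
      ≡⟨ cong ((δ a · δ b) ·_) (sym (conjugate-entry M (σ′ b) (σ′ a))) ⟩
    (δ a · δ b) · (((P ᵀ) ⊗ M) ⊗ P) (σ′ b) (σ′ a) ∎
    where
    open ≡-Reasoning
    π = perm ⟨$⟩ʳ_
    σ′ = σ ⟨$⟩ʳ_
    reorder : ∀ x dx h y dy → ((x · dx) · h) · (y · dy) ≡ (dx · dy) · ((y · h) · x)
    reorder = solve-∀

permuteˡ : ∀ {k} → Permutation′ k → ∀ m → Permutation′ (k + m)
permuteˡ {k} π m = permutation (act (π ⟨$⟩ʳ_)) (act (π ⟨$⟩ˡ_))
  (act-inverse (λ _ → inverseʳ π)) (act-inverse (λ _ → inverseˡ π))
  where
  act : (Fin k → Fin k) → Fin (k + m) → Fin (k + m)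
  act f = join k m ∘ map₁ f ∘ splitAt k

  map₁-inverse : ∀ {f g : Fin k → Fin k} → (∀ u → f (g u) ≡ u) →
                 (x : Fin k ⊎ Fin m) → map₁ f (map₁ g x) ≡ x
  map₁-inverse fg (inj₁ u) = cong inj₁ (fg u)
  map₁-inverse fg (inj₂ c) = refl

  act-inverse : ∀ {f g : Fin k → Fin k} → (∀ u → f (g u) ≡ u) → ∀ i → act f (act g i) ≡ i
  act-inverse {f} {g} fg i = begin
    join k m (map₁ f (splitAt k (join k m (map₁ g (splitAt k i)))))
      ≡⟨ cong (join k m ∘ map₁ f) (splitAt-join k m (map₁ g (splitAt k i))) ⟩
    join k m (map₁ f (map₁ g (splitAt k i)))
      ≡⟨ cong (join k m) (map₁-inverse {f} {g} fg (splitAt k i)) ⟩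
    join k m (splitAt k i)
      ≡⟨ join-splitAt k m i ⟩
    i ∎
    where open ≡-Reasoning

permuteˡ-↑ˡ : ∀ {k} (π : Permutation′ k) m u → permuteˡ π m ⟨$⟩ʳ (u ↑ˡ m) ≡ (π ⟨$⟩ʳ u) ↑ˡ m
permuteˡ-↑ˡ {k} π m u = cong (join k m ∘ map₁ (π ⟨$⟩ʳ_)) (splitAt-↑ˡ k u m)

↑ˡ≢↑ʳ : ∀ k {m} (u : Fin k) (c : Fin m) → u ↑ˡ m ≢ k ↑ʳ c
↑ˡ≢↑ʳ k {m} u c e with trans (sym (splitAt-↑ˡ k u m)) (trans (cong (splitAt k) e) (splitAt-↑ʳ k m c))
... | ()

topColumn : ∀ {m} → Mat (4 + m) → Fin m → Vec ℤ 4
topColumn {m} G c = tabulate (λ u → G (u ↑ˡ m) (4 ↑ʳ c))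

reflectColumn : Permutation′ 4 → (Fin 4 → ℤ) → Vec ℤ 4 → Vec ℤ 4
reflectColumn f d g =
  tabulate (λ u → (d u · (d 0F · - lookup g (f ⟨$⟩ʳ 0F))) · - lookup g (f ⟨$⟩ʳ u))

record Reflects {m} (f : Permutation′ 4) (d : Fin 4 → ℤ) (G G′ : Mat (4 + m)) : Set where
  field
    leading : ∀ u v → G′ (u ↑ˡ m) (v ↑ˡ m) ≡ (d u · d v) · G (f ⟨$⟩ʳ v ↑ˡ m) (f ⟨$⟩ʳ u ↑ˡ m)
    column  : ∀ c → topColumn G′ c ≡ reflectColumn f d (topColumn G c)

module BlockReflection {m} {H : Mat (4 + m)} (skew : IsSkewHadamard (4 + m) H)
                       {P : Mat (4 + m)} (isSignedPerm : IsSignedPerm (4 + m) P)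
                       (f : Permutation′ 4) (d : Fin 4 → ℤ) (d-sign : ∀ u → IsSign (d u)) where
  open SignedPerm isSignedPerm using (conjugate-isSign; conjugate-antisym)

  private
    G : Mat (4 + m)
    G = ((P ᵀ) ⊗ H) ⊗ P

    -- the sign that makes row 0 of the new matrix equal to 1 in column c
    normalise : Fin m → ℤ
    normalise c = d 0F · G (4 ↑ʳ c) (f ⟨$⟩ʳ 0F ↑ˡ m)

    δ : Fin (4 + m) → ℤ
    δ = [ d , normalise ]′ ∘ splitAt 4

    δ-sign : ∀ a → IsSign (δ a)
    δ-sign a = Sum.[_,_] {C = IsSign ∘ [ d , normalise ]′} d-sign
      (λ c → sign-· (d-sign 0F) (conjugate-isSign (proj₁ (proj₁ skew)) (4 ↑ʳ c) (f ⟨$⟩ʳ 0F ↑ˡ m)))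
      (splitAt 4 a)

    δ-↑ˡ : ∀ u → δ (u ↑ˡ m) ≡ d u
    δ-↑ˡ u = cong [ d , normalise ]′ (splitAt-↑ˡ 4 u m)

  open Reflection isSignedPerm (permuteˡ f m) δ
    using (reflected; reflected-isSignedPerm; reflected-support; conjugate-reflected)

  reflected-signedPerm : IsSignedPerm (4 + m) reflected
  reflected-signedPerm = reflected-isSignedPerm δ-sign

  reflected-leading : ∀ {Q : Fin (4 + m) → Set} → (∀ u r → P r (u ↑ˡ m) ≢ 0ℤ → Q r) →
                      ∀ u r → reflected r (u ↑ˡ m) ≢ 0ℤ → Q r
  reflected-leading leading u r ≢0 =
    leading (f ⟨$⟩ʳ u) r
      (subst (λ b → P r b ≢ 0ℤ) (permuteˡ-↑ˡ f m u) (reflected-support {r} {u ↑ˡ m} ≢0))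

  reflects : Reflects f d (((P ᵀ) ⊗ H) ⊗ P) (((reflected ᵀ) ⊗ (H ᵀ)) ⊗ reflected)
  reflects = record { leading = leading ; column = column }
    where
    open ≡-Reasoning
    G′ = ((reflected ᵀ) ⊗ (H ᵀ)) ⊗ reflected
    σ = permuteˡ f m ⟨$⟩ʳ_

    leading : ∀ u v → G′ (u ↑ˡ m) (v ↑ˡ m) ≡ (d u · d v) · G (f ⟨$⟩ʳ v ↑ˡ m) (f ⟨$⟩ʳ u ↑ˡ m)
    leading u v = begin
      G′ (u ↑ˡ m) (v ↑ˡ m)
        ≡⟨ conjugate-reflected H (u ↑ˡ m) (v ↑ˡ m) ⟩
      (δ (u ↑ˡ m) · δ (v ↑ˡ m)) · G (σ (v ↑ˡ m)) (σ (u ↑ˡ m))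
        ≡⟨ cong₂ _·_ (cong₂ _·_ (δ-↑ˡ u) (δ-↑ˡ v)) (cong₂ G (permuteˡ-↑ˡ f m v) (permuteˡ-↑ˡ f m u)) ⟩
      (d u · d v) · G (f ⟨$⟩ʳ v ↑ˡ m) (f ⟨$⟩ʳ u ↑ˡ m) ∎

    column : ∀ c → topColumn G′ c ≡ reflectColumn f d (topColumn G c)
    column c = tabulate-cong λ u → begin
      G′ (u ↑ˡ m) (4 ↑ʳ c)
        ≡⟨ conjugate-reflected H (u ↑ˡ m) (4 ↑ʳ c) ⟩
      (δ (u ↑ˡ m) · normalise c) · G (4 ↑ʳ c) (σ (u ↑ˡ m))
        ≡⟨ cong₂ (λ x y → (x · normalise c) · G (4 ↑ʳ c) y) (δ-↑ˡ u) (permuteˡ-↑ˡ f m u) ⟩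
      (d u · (d 0F · G (4 ↑ʳ c) (f0 ↑ˡ m))) · G (4 ↑ʳ c) (f ⟨$⟩ʳ u ↑ˡ m)
        ≡⟨ cong₂ (λ x y → (d u · (d 0F · x)) · y) (antisym f0) (antisym (f ⟨$⟩ʳ u)) ⟩
      (d u · (d 0F · - G (f0 ↑ˡ m) (4 ↑ʳ c))) · - G (f ⟨$⟩ʳ u ↑ˡ m) (4 ↑ʳ c)
        ≡⟨ cong₂ (λ x y → (d u · (d 0F · - x)) · - y)
                 (lookup∘tabulate entry f0) (lookup∘tabulate entry (f ⟨$⟩ʳ u)) ⟨
      (d u · (d 0F · - lookup (topColumn G c) f0)) · - lookup (topColumn G c) (f ⟨$⟩ʳ u) ∎
      where
      f0 = f ⟨$⟩ʳ 0F
      entry : Fin 4 → ℤ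
      entry w = G (w ↑ˡ m) (4 ↑ʳ c)
      antisym : ∀ v → G (4 ↑ʳ c) (v ↑ˡ m) ≡ - G (v ↑ˡ m) (4 ↑ʳ c)
      antisym v = conjugate-antisym (skewHadamard-antisym skew) (↑ˡ≢↑ʳ 4 v c)

  transposed-frame : ∀ {Q : Fin (4 + m) → Set} (Ψ : Mat (4 + m) → Set) →
    (∀ u r → P r (u ↑ˡ m) ≢ 0ℤ → Q r) →
    (∀ {G′} → Reflects f d (((P ᵀ) ⊗ H) ⊗ P) G′ → Ψ G′) →
    ∃ λ P′ → IsSignedPerm (4 + m) P′ × (∀ u r → P′ r (u ↑ˡ m) ≢ 0ℤ → Q r) ×
             Ψ (((P′ ᵀ) ⊗ (H ᵀ)) ⊗ P′)
  transposed-frame Ψ leading transfer =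
    reflected , reflected-signedPerm , reflected-leading leading , transfer reflects

_≟ᵥ_ : DecidableEquality (Vec ℤ 4)
_≟ᵥ_ = ≡-dec ℤ._≟_

open import Data.List.Relation.Unary.Unique.DecPropositional _≟ᵥ_ using (unique?)
open import Data.List.Membership.DecPropositional _≟ᵥ_ using (_∈?_)

-- In the order in which (F1) and (F2) list their counts.
normalisedPatterns : List (Vec ℤ 4)
normalisedPatterns =
  pat 1ℤ 1ℤ 1ℤ 1ℤ ∷ pat 1ℤ 1ℤ 1ℤ -1ℤ ∷ pat 1ℤ 1ℤ -1ℤ 1ℤ ∷ pat 1ℤ 1ℤ -1ℤ -1ℤ ∷
  pat 1ℤ -1ℤ 1ℤ 1ℤ ∷ pat 1ℤ -1ℤ 1ℤ -1ℤ ∷ pat 1ℤ -1ℤ -1ℤ 1ℤ ∷ pat 1ℤ -1ℤ -1ℤ -1ℤ ∷ []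

Normalised : Vec ℤ 4 → Set
Normalised g = True (g ∈? normalisedPatterns)

columns-normalised : ∀ {m} (G : Mat (4 + m)) →
  sum (map (colCount m G) normalisedPatterns) ≡ m → ∀ c → Normalised (topColumn G c)
columns-normalised G total = countᶠ-full _
  (trans (sym (countᶠ-distinct _≟ᵥ_ (topColumn G) (from-yes (unique? normalisedPatterns)))) total)

F1-total : ∀ {m G s t} → F1 m G s t → sum (map (colCount m G) normalisedPatterns) ≡ m
F1-total {m} {G} {suc s} {suc t} (_ , _ , size , _ , c₁ , c₂ , c₃ , c₄ , c₅ , c₆ , c₇ , c₈) =
  ℕ.+-cancelˡ-≡ 4 _ _ (begin
    4 + sum (map (colCount m G) normalisedPatterns)
      ≡⟨ cong (λ xs → 4 + sum xs) (Pointwise-≡⇒≡ (c₁ ∷ c₂ ∷ c₃ ∷ c₄ ∷ c₅ ∷ c₆ ∷ c₇ ∷ c₈ ∷ [])) ⟩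
    4 + (s + (t + (suc t + (s + (suc t + (suc s + (suc s + (t + 0))))))))
      ≡⟨ counts s t ⟩
    4 * (suc s + suc t)
      ≡⟨ size ⟩
    4 + m ∎)
  where
  open ≡-Reasoning
  counts : ∀ s t →
    4 + (s + (t + (suc t + (s + (suc t + (suc s + (suc s + (t + 0)))))))) ≡ 4 * (suc s + suc t)
  counts = ℕ-solve-∀

F2-total : ∀ {m G s t} → F2 m G s t → sum (map (colCount m G) normalisedPatterns) ≡ m
F2-total {m} {G} {s} {suc t} (_ , size , _ , c₁ , c₂ , c₃ , c₄ , c₅ , c₆ , c₇ , c₈) =
  ℕ.+-cancelˡ-≡ 4 _ _ (begin
    4 + sum (map (colCount m G) normalisedPatterns)
      ≡⟨ cong (λ xs → 4 + sum xs) (Pointwise-≡⇒≡ (c₁ ∷ c₂ ∷ c₃ ∷ c₄ ∷ c₅ ∷ c₆ ∷ c₇ ∷ c₈ ∷ [])) ⟩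
    4 + (s + (t + (t + (s + (t + (s + (s + (t + 0))))))))
      ≡⟨ counts s t ⟩
    4 * (s + suc t)
      ≡⟨ size ⟩
    4 + m ∎)
  where
  open ≡-Reasoning
  counts : ∀ s t → 4 + (s + (t + (t + (s + (t + (s + (s + (t + 0)))))))) ≡ 4 * (s + suc t)
  counts = ℕ-solve-∀

-- The {True …} arguments below, like Normalised, are finite checks that evaluation discharges
-- at the concrete f, d and patterns where the lemmas are used.
module Reflected {m} {G G′ : Mat (4 + m)} {f : Permutation′ 4} {d : Fin 4 → ℤ}
                 (reflects : Reflects f d G G′) where

  leadingBlock-reflect : ∀ {X Y : Fin 4 → Fin 4 → ℤ} → LeadingBlock m G X →
    {True (all? λ u → all? λ v → (d u · d v) · X (f ⟨$⟩ʳ v) (f ⟨$⟩ʳ u) ℤ.≟ Y u v)} →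
    LeadingBlock m G′ Y
  leadingBlock-reflect {X} {Y} lead {reflect} u v = begin
    G′ (u ↑ˡ m) (v ↑ˡ m)                        ≡⟨ Reflects.leading reflects u v ⟩
    (d u · d v) · G (f′ v ↑ˡ m) (f′ u ↑ˡ m)     ≡⟨ cong ((d u · d v) ·_) (lead (f′ v) (f′ u)) ⟩
    (d u · d v) · X (f′ v) (f′ u)               ≡⟨ toWitness reflect u v ⟩
    Y u v                                       ∎
    where
    open ≡-Reasoning
    f′ = f ⟨$⟩ʳ_

  colCount-reflect : sum (map (colCount m G) normalisedPatterns) ≡ m →
    {True (All.all? (λ p → reflectColumn f d (reflectColumn f d p) ≟ᵥ p) normalisedPatterns)} →
    ∀ p → {Normalised p} → colCount m G′ p ≡ colCount m G (reflectColumn f d p)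
  colCount-reflect total {involutive} p {p-normalised} = trans
    (countᶠ-cong λ c → cong (λ g → ⌊ g ≟ᵥ p ⌋) (Reflects.column reflects c))
    (countᶠ-involution _≟ᵥ_ {S = Normalised} (reflectColumn f d)
       (λ {g} g-normalised →
          All.lookup (toWitness involutive) (toWitness {a? = g ∈? normalisedPatterns} g-normalised))
       (topColumn G) (columns-normalised G total) p-normalised)

-- reflectColumn reverse (λ _ → 1ℤ) sends (1, a, b, c) to (1, c · b, c · a, c).
F1-reflect : ∀ {m} {G G′ : Mat (4 + m)} {s t} → Reflects reverse (λ _ → 1ℤ) G G′ →
  F1 m G s t → F1 m G′ s t
F1-reflect {G = G} reflects F@(s≥1 , t≥1 , size , lead , c₁ , c₂ , c₃ , c₄ , c₅ , c₆ , c₇ , c₈) =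
  s≥1 , t≥1 , size , leadingBlock-reflect lead ,
  trans (count (pat 1ℤ 1ℤ 1ℤ 1ℤ)) c₁ , trans (count (pat 1ℤ 1ℤ 1ℤ -1ℤ)) c₈ ,
  trans (count (pat 1ℤ 1ℤ -1ℤ 1ℤ)) c₅ , trans (count (pat 1ℤ 1ℤ -1ℤ -1ℤ)) c₄ ,
  trans (count (pat 1ℤ -1ℤ 1ℤ 1ℤ)) c₃ , trans (count (pat 1ℤ -1ℤ 1ℤ -1ℤ)) c₆ ,
  trans (count (pat 1ℤ -1ℤ -1ℤ 1ℤ)) c₇ , trans (count (pat 1ℤ -1ℤ -1ℤ -1ℤ)) c₂
  where
  open Reflected reflects
  count = colCount-reflect (F1-total {G = G} F)

signs₂ : Fin 4 → ℤ
signs₂ 0F      = 1ℤ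
signs₂ (suc _) = -1ℤ

signs₂-isSign : ∀ u → IsSign (signs₂ u)
signs₂-isSign 0F      = inj₁ refl
signs₂-isSign (suc _) = inj₂ refl

-- reflectColumn (transpose 2F 3F) signs₂ sends (1, a, b, c) to (1, - a, - c, - b).
F2-reflect : ∀ {m} {G G′ : Mat (4 + m)} {s t} → Reflects (transpose 2F 3F) signs₂ G G′ →
  F2 m G s t → F2 m G′ (t ∸ 1) (suc s)
F2-reflect {G = G} {s = s} {suc t} reflects
           F@(_ , size , lead , c₁ , c₂ , c₃ , c₄ , c₅ , c₆ , c₇ , c₈) =
  s≤s z≤n , trans (cong (4 *_) (+-suc-comm t s)) size , leadingBlock-reflect lead ,
  trans (count (pat 1ℤ 1ℤ 1ℤ 1ℤ)) c₈ , trans (count (pat 1ℤ 1ℤ 1ℤ -1ℤ)) c₆ ,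
  trans (count (pat 1ℤ 1ℤ -1ℤ 1ℤ)) c₇ , trans (count (pat 1ℤ 1ℤ -1ℤ -1ℤ)) c₅ ,
  trans (count (pat 1ℤ -1ℤ 1ℤ 1ℤ)) c₄ , trans (count (pat 1ℤ -1ℤ 1ℤ -1ℤ)) c₂ ,
  trans (count (pat 1ℤ -1ℤ -1ℤ 1ℤ)) c₃ , trans (count (pat 1ℤ -1ℤ -1ℤ -1ℤ)) c₁
  where
  open Reflected reflects
  count = colCount-reflect (F2-total {G = G} F)
  +-suc-comm : ∀ t s → t + suc s ≡ s + suc t
  +-suc-comm = ℕ-solve-∀

module Transpose {m} {H : Mat (4 + m)} (skew : IsSkewHadamard (4 + m) H)
                 (i j k l : Fin (4 + m)) where

  SelectsQuadruple : Mat (4 + m) → Set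
  SelectsQuadruple P =
    ∀ (u : Fin 4) (r : Fin (4 + m)) → P r (u ↑ˡ m) ≢ 0ℤ → r ≡ i ⊎ (r ≡ j ⊎ (r ≡ k ⊎ r ≡ l))

  F1-transpose : ∀ {P s t} → IsSignedPerm (4 + m) P → SelectsQuadruple P →
    F1 m (((P ᵀ) ⊗ H) ⊗ P) s t → HasSkewType m (H ᵀ) i j k l (min s t) 1
  F1-transpose {s = s} {t} isSignedPerm selects F =
    transposed-frame (λ G′ → TypeValue m G′ (min s t) 1) selects
      (λ reflects → inj₁ (s , t , F1-reflect {s = s} {t} reflects F , refl , refl))
    where open BlockReflection skew isSignedPerm reverse (λ _ → 1ℤ) (λ _ → inj₁ refl)

  F2-transpose : ∀ {P s t} → IsSignedPerm (4 + m) P → SelectsQuadruple P →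
    F2 m (((P ᵀ) ⊗ H) ⊗ P) s t →
    (t ∸ 1 ≤ suc s → HasSkewType m (H ᵀ) i j k l (t ∸ 1) 2) ×
    (suc s < t ∸ 1 → HasSkewType m (H ᵀ) i j k l (suc s) 0)
  F2-transpose {s = s} {t} isSignedPerm selects F =
    (λ t∸1≤1+s → transposed (inj₁ (t∸1≤1+s , refl , refl))) ,
    (λ 1+s<t∸1 → transposed (inj₂ (1+s<t∸1 , refl , refl)))
    where
    open BlockReflection skew isSignedPerm (transpose 2F 3F) signs₂ signs₂-isSign
    transposed : ∀ {a b} →
      (t ∸ 1 ≤ suc s × a ≡ t ∸ 1 × b ≡ 2) ⊎ (suc s < t ∸ 1 × a ≡ suc s × b ≡ 0) →
      HasSkewType m (H ᵀ) i j k l a b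
    transposed {a} {b} case = transposed-frame (λ G′ → TypeValue m G′ a b) selects
      (λ reflects → inj₂ (t ∸ 1 , suc s , F2-reflect {s = s} {t} reflects F , case))

  type0-transpose : ∀ t → HasSkewType m H i j k l t 0 → HasSkewType m (H ᵀ) i j k l (t ∸ 1) 2
  type0-transpose _ (_ , _ , _ , inj₁ (_ , _ , _ , _ , ()))
  type0-transpose _ (_ , _ , _ , inj₂ (_ , _ , _ , inj₁ (_ , _ , ())))
  type0-transpose _ (P , isSignedPerm , selects , inj₂ (s , t , F , inj₂ (t<s , refl , refl))) =
    proj₁ (F2-transpose {P} isSignedPerm selects F)
      (ℕ.≤-trans (ℕ.m∸n≤m t 1) (ℕ.<⇒≤ (ℕ.m<n⇒m<1+n t<s)))

  type1-transpose : ∀ t → HasSkewType m H i j k l t 1 → HasSkewType m (H ᵀ) i j k l t 1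
  type1-transpose _ (P , isSignedPerm , selects , inj₁ (_ , _ , F , refl , refl)) =
    F1-transpose {P} isSignedPerm selects F
  type1-transpose _ (_ , _ , _ , inj₂ (_ , _ , _ , inj₁ (_ , _ , ())))
  type1-transpose _ (_ , _ , _ , inj₂ (_ , _ , _ , inj₂ (_ , _ , ())))

  type2-transpose : ∀ s → HasSkewType m H i j k l s 2 →
    (8 * s ≡ 4 + m → HasSkewType m (H ᵀ) i j k l (s ∸ 1) 2) ×
    (8 * s + 4 ≡ 4 + m → HasSkewType m (H ᵀ) i j k l s 2) ×
    (8 * (s + 1) ≡ 4 + m → HasSkewType m (H ᵀ) i j k l (s + 1) 2) ×
    (8 * s ≢ 4 + m → 8 * s + 4 ≢ 4 + m → 8 * (s + 1) ≢ 4 + m →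
      HasSkewType m (H ᵀ) i j k l (s + 1) 0)
  type2-transpose _ (_ , _ , _ , inj₁ (_ , _ , _ , _ , ()))
  type2-transpose _ (_ , _ , _ , inj₂ (_ , _ , _ , inj₂ (_ , _ , ())))
  -- Since 4 + m = 4 (s + t), the three equations say that t is s, s + 1 or s + 2.
  type2-transpose _ (P , isSignedPerm , selects , inj₂ (s , t , F , inj₁ (s≤t , refl , refl))) =
    (λ n≡8s → type≤ (cong (_∸ 1) (sym (t≡ (8s s) n≡8s))) (ℕ.≤-trans (ℕ.m∸n≤m s 1) (ℕ.n≤1+n s))) ,
    (λ n≡8s+4 → type≤ (cong (_∸ 1) (sym (t≡ (8s+4 s) n≡8s+4))) (ℕ.n≤1+n s)) ,
    (λ n≡8s+8 → type≤ (trans (ℕ.+-comm s 1) (cong (_∸ 1) (sym (t≡ (8s+8 s) n≡8s+8))))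
                      (ℕ.≤-reflexive (ℕ.+-comm s 1))) ,
    (λ n≢8s n≢8s+4 n≢8s+8 → subst (λ a → HasSkewType m (H ᵀ) i j k l a 0) (ℕ.+-comm 1 s)
      (proj₂ transposed (ℕ.∸-monoˡ-≤ 1 (3+s≤t n≢8s n≢8s+4 n≢8s+8))))
    where
    transposed = F2-transpose {P} isSignedPerm selects F

    8s : ∀ s → 8 * s ≡ 4 * (s + s)
    8s = ℕ-solve-∀
    8s+4 : ∀ s → 8 * s + 4 ≡ 4 * (s + suc s)
    8s+4 = ℕ-solve-∀
    8s+8 : ∀ s → 8 * (s + 1) ≡ 4 * (s + suc (suc s))
    8s+8 = ℕ-solve-∀

    size : 4 * (s + t) ≡ 4 + m
    size = proj₁ (proj₂ F)

    t≡ : ∀ {n t′} → n ≡ 4 * (s + t′) → n ≡ 4 + m → t ≡ t′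
    t≡ n≡ n≡4+m = ℕ.+-cancelˡ-≡ s _ _ (ℕ.*-cancelˡ-≡ _ _ 4 (trans size (trans (sym n≡4+m) n≡)))

    t≢ : ∀ {n t′} → n ≡ 4 * (s + t′) → n ≢ 4 + m → t′ ≢ t
    t≢ n≡ n≢4+m refl = n≢4+m (trans n≡ size)

    type≤ : ∀ {a} → a ≡ t ∸ 1 → a ≤ suc s → HasSkewType m (H ᵀ) i j k l a 2
    type≤ refl = proj₁ transposed

    3+s≤t : 8 * s ≢ 4 + m → 8 * s + 4 ≢ 4 + m → 8 * (s + 1) ≢ 4 + m → 3 + s ≤ t
    3+s≤t n≢8s n≢8s+4 n≢8s+8 =
      ℕ.≤∧≢⇒< (ℕ.≤∧≢⇒< (ℕ.≤∧≢⇒< s≤t (t≢ (8s s) n≢8s)) (t≢ (8s+4 s) n≢8s+4)) (t≢ (8s+8 s) n≢8s+8)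

lemma2p2 : ∀ (m : ℕ) (H : Mat (4 + m)) (i j k l : Fin (4 + m)) →
    IsSkewHadamard (4 + m) H → Distinct4 i j k l →
    (∀ t → HasSkewType m H i j k l t 0 → HasSkewType m (H ᵀ) i j k l (t ∸ 1) 2) ×
    (∀ t → HasSkewType m H i j k l t 1 → HasSkewType m (H ᵀ) i j k l t 1) ×
    (∀ s → HasSkewType m H i j k l s 2 →
      (8 * s ≡ 4 + m → HasSkewType m (H ᵀ) i j k l (s ∸ 1) 2) ×
      (8 * s + 4 ≡ 4 + m → HasSkewType m (H ᵀ) i j k l s 2) ×
      (8 * (s + 1) ≡ 4 + m → HasSkewType m (H ᵀ) i j k l (s + 1) 2) ×
      (8 * s ≢ 4 + m → 8 * s + 4 ≢ 4 + m → 8 * (s + 1) ≢ 4 + m →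
        HasSkewType m (H ᵀ) i j k l (s + 1) 0))
lemma2p2 m H i j k l skew _ = type0-transpose , type1-transpose , type2-transpose
  where open Transpose skew i j k l
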